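{- Let $\Gamma=(G,\sigma)$ be an unbalanced unicyclic signed graph on $n$ vertices $1,\ldots,n$ and $n$ edges $e_1,\ldots,e_n$, with unique cycle $C$ and incidence matrix $N$. Then $N$ is invertible and, for every edge $e_i$ and vertex $j$, \[ (N^{ -1})_{ij}=w(e_i)\begin{cases}\tfrac12\,\mathrm{sgn}(P_{e_i^t-j}) & \text{if } e_i\in C,\\ 0 & \text{if } e_i\notin C \text{ and } j\in G\setminus e_i[C],\\ -\mathrm{sgn}(P_{e_i-j}) & \text{if } e_i \text{ is positive}, e_i\notin E(C),\ j\notin G\setminus e_i[C] \text{ and } j\in G_h(e_i),\\ \mathrm{sgn}(P_{e_i-j}) & \text{otherwise.}\end{cases} \]
   Context: A signed graph $\Gamma=(G,\sigma)$ consists of a simple graph $G=(V,E)$, $V=\{1,\ldots,n\}$, and $\sigma:E\to\{ -1,1\}$; $e$ is positive if $\sigma(e)=1$, negative if $\sigma(e)=-1$. A cycle is unbalanced if it contains an odd number of negative edges; a unicyclic signed graph is unbalanced if its unique cycle is. The sign $\mathrm{sgn}(P)$ of a path $P$ is the product of $\sigma$ over its edges (1 for the empty path). An incidence matrix of $\Gamma$ is a matrix $N=[n_{k\ell}]$ with rows indexed by vertices and columns by edges such that for each edge $e_\ell=\{i,j\}$ column $\ell$ has exactly two nonzero entries $n_{i\ell},n_{j\ell}\in\{1,-1\}$, with $n_{i\ell}=n_{j\ell}$ if $e_\ell$ is negative and $n_{i\ell}=-n_{j\ell}$ if $e_\ell$ is positive. Head/tail: a positive edge $e_\ell=\{l,m\}$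 with $n_{l\ell}=1,n_{m\ell}=-1$ has tail $l$ and head $m$; a negative edge $\{l,m\}$ with $l<m$ has tail $l$ and head $m$. $w(e_\ell)=-1$ if $e_\ell$ is negative with both nonzero entries of column $\ell$ equal to $-1$, and $w(e_\ell)=1$ otherwise. For $e_i\notin C$: $G\setminus e_i[C]$ is the connected component of $G\setminus e_i$ containing $C$, and $G_h(e_i)$ is the connected component of $G\setminus e_i$ containing the head of $e_i$; $P_{e_i-j}$ is the shortest path between vertex $j$ and edge $e_i$ not containing $e_i$. For $e_i\in C$: $e_i^t$ is the tail of $e_i$ and $P_{e_i^t-j}$ is the unique path between $e_i^t$ and $j$ in the tree $G\setminus e_i$. -}

module Defs where

open import Data.Nat as ℕ using (ℕ; zero; suc; _≤_; _%_)
open import Data.Integer as ℤ using (ℤ)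
open import Data.Rational as ℚ using (ℚ; 0ℚ; 1ℚ; ½)
open import Data.Fin as Fin using (Fin; toℕ)
open import Data.Fin.Properties using () renaming (_≟_ to _≟F_)
open import Data.Sign as Sign using (Sign)
open import Data.Bool using (Bool; true; false; _∧_; _∨_; if_then_else_)
open import Data.List using (List; []; _∷_; foldr; map; length)
open import Data.List.Relation.Unary.Unique.Propositional using (Unique)
open import Data.Product using (Σ; ∃; _×_; _,_)
open import Data.Sum using (_⊎_)
open import Data.Unit using (⊤)
open import Relation.Nullary using (¬_; does)
open import Relation.Binary.PropositionalEquality using (_≡_; _≢_)

allF : (k : ℕ) → List (Fin k)
allF k = Data.List.tabulate {n = k} (λ i → i)

sumℚ : {k : ℕ} → (Fin k → ℚ) → ℚ
sumℚ {k} f = foldr (λ i acc → f i ℚ.+ acc) 0ℚ (allF k)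

countB : {k : ℕ} → (Fin k → Bool) → ℕ
countB {k} f = foldr (λ i acc → (if f i then 1 else 0) ℕ.+ acc) 0 (allF k)

_∈E_ : {m : ℕ} → Fin m → (Fin m → Bool) → Set
e ∈E C = C e ≡ true

-- Simple graphs on vertices Fin n with edges Fin m.
-- Edge e has endpoints ends₁ e and ends₂ e (an unordered pair).

record Graph (n m : ℕ) : Set where
  field
    ends₁ ends₂ : Fin m → Fin n
    loopless    : ∀ e → ends₁ e ≢ ends₂ e
    simple      : ∀ e f →
                  ((ends₁ e ≡ ends₁ f × ends₂ e ≡ ends₂ f) ⊎
                   (ends₁ e ≡ ends₂ f × ends₂ e ≡ ends₁ f)) → e ≡ f

module _ {n m : ℕ} (G : Graph n m) where
  open Graph G

  Joins : Fin m → Fin n → Fin n → Set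
  Joins e a c = (ends₁ e ≡ a × ends₂ e ≡ c) ⊎ (ends₂ e ≡ a × ends₁ e ≡ c)

  Inc : Fin m → Fin n → Set
  Inc e v = v ≡ ends₁ e ⊎ v ≡ ends₂ e

  incᵇ : Fin m → Fin n → Bool
  incᵇ e v = does (v ≟F ends₁ e) ∨ does (v ≟F ends₂ e)

  data Walk (S : Fin m → Set) : Fin n → Fin n → Set where
    []   : ∀ {a} → Walk S a a
    step : ∀ {a c b} (e : Fin m) → S e → Joins e a c → Walk S c b → Walk S a b

  vertices : ∀ {S a b} → Walk S a b → List (Fin n)
  vertices {a = a} [] = a ∷ []
  vertices {a = a} (step e _ _ w) = a ∷ vertices w

  edges : ∀ {S a b} → Walk S a b → List (Fin m)
  edges [] = []
  edges (step e _ _ w) = e ∷ edges w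

  len : ∀ {S a b} → Walk S a b → ℕ
  len w = length (edges w)

  IsPath : ∀ {S a b} → Walk S a b → Set
  IsPath w = Unique (vertices w)

  Connected : Set
  Connected = ∀ a b → Walk (λ _ → ⊤) a b

  degIn : (Fin m → Bool) → Fin n → ℕ
  degIn C v = countB (λ e → C e ∧ incᵇ e v)

  OnE : (Fin m → Bool) → Fin n → Set
  OnE C v = ∃ λ e → e ∈E C × Inc e v

  IsCycle : (Fin m → Bool) → Set
  IsCycle C = (∃ λ e → e ∈E C)
            × (∀ v → degIn C v ≡ 0 ⊎ degIn C v ≡ 2)
            × (∀ a b → OnE C a → OnE C b → Walk (λ e → e ∈E C) a b)

  UnicyclicWith : (Fin m → Bool) → Set
  UnicyclicWith C = Connected × IsCycle C × (∀ C' → IsCycle C' → C' ≡ C)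

isNegᵇ : Sign → Bool
isNegᵇ Sign.- = true
isNegᵇ Sign.+ = false

signℚ : Sign → ℚ
signℚ Sign.+ = 1ℚ
signℚ Sign.- = ℚ.- 1ℚ

module _ {n m : ℕ} (G : Graph n m) (σ : Fin m → Sign) where
  open Graph G

  Unbalanced : (Fin m → Bool) → Set
  Unbalanced C = countB (λ e → C e ∧ isNegᵇ (σ e)) % 2 ≡ 1

  sgn : ∀ {S a b} → Walk G S a b → Sign
  sgn w = foldr (λ e s → σ e Sign.* s) Sign.+ (edges G w)

  -- N (rows = vertices, columns = edges) is an incidence matrix of (G, σ)
  IsIncidence : (Fin n → Fin m → ℤ) → Set
  IsIncidence N = ∀ ℓ →
      (∀ k → ¬ Inc G ℓ k → N k ℓ ≡ ℤ.0ℤ)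
    × (N (ends₁ ℓ) ℓ ≡ ℤ.1ℤ ⊎ N (ends₁ ℓ) ℓ ≡ ℤ.-1ℤ)
    × (N (ends₂ ℓ) ℓ ≡ ℤ.1ℤ ⊎ N (ends₂ ℓ) ℓ ≡ ℤ.-1ℤ)
    × (σ ℓ ≡ Sign.- → N (ends₁ ℓ) ℓ ≡ N (ends₂ ℓ) ℓ)
    × (σ ℓ ≡ Sign.+ → N (ends₁ ℓ) ℓ ≡ ℤ.- N (ends₂ ℓ) ℓ)

  module _ (N : Fin n → Fin m → ℤ) where

    tail : Fin m → Fin n
    tail ℓ with σ ℓ
    ... | Sign.+ = if does (N (ends₁ ℓ) ℓ ℤ.≟ ℤ.1ℤ) then ends₁ ℓ else ends₂ ℓ
    ... | Sign.- = if does (toℕ (ends₁ ℓ) ℕ.<? toℕ (ends₂ ℓ)) then ends₁ ℓ else ends₂ ℓ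

    head : Fin m → Fin n
    head ℓ with σ ℓ
    ... | Sign.+ = if does (N (ends₁ ℓ) ℓ ℤ.≟ ℤ.1ℤ) then ends₂ ℓ else ends₁ ℓ
    ... | Sign.- = if does (toℕ (ends₁ ℓ) ℕ.<? toℕ (ends₂ ℓ)) then ends₂ ℓ else ends₁ ℓ

    wt : Fin m → ℚ
    wt ℓ = if isNegᵇ (σ ℓ) ∧ does (N (ends₁ ℓ) ℓ ℤ.≟ ℤ.-1ℤ)
                           ∧ does (N (ends₂ ℓ) ℓ ℤ.≟ ℤ.-1ℤ)
           then ℚ.- 1ℚ else 1ℚ

  Avoid : Fin m → Fin m → Set
  Avoid e f = f ≢ e

  -- j lies in G \ e [C]: the component of G \ e containing C
  InCompC : (Fin m → Bool) → Fin m → Fin n → Set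
  InCompC C e j = ∃ λ v → OnE G C v × Walk G (Avoid e) j v

  -- j lies in G_h(e): the component of G \ e containing the head of e
  InGh : (Fin n → Fin m → ℤ) → Fin m → Fin n → Set
  InGh N e j = Walk G (Avoid e) j (head N e)

  ShortestToEdge : Fin m → (j : Fin n) → Set
  ShortestToEdge e j = Σ (Fin n) λ x → Inc G e x × Σ (Walk G (Avoid e) j x) λ P →
      IsPath G P × (∀ y → Inc G e y → (Q : Walk G (Avoid e) j y) → len G P ≤ len G Q)

  EntrySpec : (Fin m → Bool) → (Fin n → Fin m → ℤ) → Fin m → Fin n → ℚ → Set
  EntrySpec C N i j q =
      (i ∈E C → (P : Walk G (Avoid i) (tail N i) j) → IsPath G P →
         q ≡ wt N i ℚ.* (½ ℚ.* signℚ (sgn P)))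
    × (¬ i ∈E C → InCompC C i j → q ≡ 0ℚ)
    × (¬ i ∈E C → ¬ InCompC C i j → σ i ≡ Sign.+ → InGh N i j →
         (sp : ShortestToEdge i j) →
         q ≡ wt N i ℚ.* ℚ.- signℚ (sgn (Data.Product.proj₁ (Data.Product.proj₂ (Data.Product.proj₂ sp)))))
    × (¬ i ∈E C → ¬ InCompC C i j → ¬ (σ i ≡ Sign.+ × InGh N i j) →
         (sp : ShortestToEdge i j) →
         q ≡ wt N i ℚ.* signℚ (sgn (Data.Product.proj₁ (Data.Product.proj₂ (Data.Product.proj₂ sp)))))

toℚ : ℤ → ℚ
toℚ z = z ℚ./ 1

idℚ : {k : ℕ} → Fin k → Fin k → ℚ
idℚ a b = if does (a ≟F b) then 1ℚ else 0ℚ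

-- M (rows = edges, columns = vertices) is a two-sided inverse of N
IsInverse : {n m : ℕ} → (Fin n → Fin m → ℤ) → (Fin m → Fin n → ℚ) → Set
IsInverse N M =
    (∀ i k → sumℚ (λ j → M i j ℚ.* toℚ (N j k)) ≡ idℚ i k)
  × (∀ a b → sumℚ (λ ℓ → toℚ (N a ℓ) ℚ.* M ℓ b) ≡ idℚ a b)

-- Row i of a left inverse of N is a vector x with x · N_k = δ_ik for every column k.
-- For k ≠ i this says x(v) = σ(k) x(u) across k = uv, so along any walk avoiding e_i the entries
-- of x are multiplied by the sign of the walk.  If this holds on every edge of the cycle except e_i, then x = ±x(u) around C, and
-- counting sign changes modulo 2 against the odd number of negative cycle edges (a handshake
-- argument, needing only even degrees on C) gives x(v) = −σ(e_i) x(u) across e_i = uv.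
-- For x orthogonal to all columns this forces x = 0 on C, hence everywhere by connectivity, so N
-- has trivial left kernel and is invertible by Gaussian elimination over ℚ.  For e_i ∈ C the
-- equation x · N_i = 1 then gives x = ½ N_{·i} at both ends of e_i; for e_i ∉ C, x vanishes on the
-- component of G ∖ e_i containing C and equals N_{·i} at the other end of e_i.

module Submission where

open import Defs
open import Algebra.Bundles using (CommutativeMonoid; CommutativeRing)
open import Data.Bool using (Bool; true; false; not; _∧_; _∨_; _xor_; if_then_else_)
open import Data.Bool.Properties
  using (xor-∧-commutativeRing; not-distribˡ-xor; not-involutive; not-injective; ∧-distribˡ-xor;
         ∧-zeroʳ; ∧-identityʳ; ∨-zeroʳ; xor-same; xor-identityʳ; xor-comm; true-xor; xor-annihilates-not)
open import Data.Empty using (⊥-elim)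
open import Data.Fin using (Fin; zero; suc; toℕ; punchIn; punchOut)
open import Data.Fin.Properties using (any?; punchInᵢ≢i; punchIn-injective; punchIn-punchOut) renaming (_≟_ to _≟F_)
open import Data.Integer as ℤ using (ℤ)
open import Data.Integer.Properties using (neg-involutive)
import Data.List as List
open import Data.Nat as ℕ using (ℕ; zero; suc; s≤s; _%_)
open import Data.Nat.Properties using (m<n⇒m<1+n; n<1+n)
open import Data.Product using (Σ; Σ-syntax; ∃; _×_; _,_; proj₁; proj₂)
open import Data.Rational as ℚ using (ℚ; 0ℚ; 1ℚ; ½; _+_; _*_; -_; _-_; 1/_)
open import Data.Rational.Properties
  using (_≟_; +-*-commutativeRing; +-0-group; +-comm; +-identityˡ; +-identityʳ; +-inverseˡ;
         *-comm; *-assoc; *-identityˡ; *-identityʳ; *-zeroˡ; *-zeroʳ; *-inverseˡ; neg-distribˡ-*)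
open import Data.Rational.Solver using (module +-*-Solver)
open import Data.Sign as Sign using (Sign)
open import Data.Sum using (_⊎_; inj₁; inj₂; [_,_])
open import Data.Unit using (⊤)
open import Data.Vec.Functional as Vector using (Vector; _∷_; insertAt; removeAt)
open import Data.Vec.Functional.Properties
  using (removeAt-punchOut; insertAt-lookup; insertAt-punchIn; removeAt-insertAt)
open import Function using (_∘_; const; id)
open import Function.Bundles using (mk⇔)
open import Relation.Binary.PropositionalEquality
  using (_≡_; _≢_; _≗_; refl; sym; trans; cong; cong₂; subst; module ≡-Reasoning)
open import Relation.Nullary using (¬_; Dec; yes; no; does; ¬?; contradiction)
open import Relation.Nullary.Decidable using (dec-true; dec-false; decidable-stable; does-⇔)

module CommutativeMonoidSum {c ℓ} (M : CommutativeMonoid c ℓ) where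
  open CommutativeMonoid M using (Carrier; _≈_; _∙_; ε; setoid; ∙-congˡ; identityʳ)
  open import Algebra.Properties.CommutativeMonoid.Sum M
  open import Relation.Binary.Reasoning.Setoid setoid

  sum-single : ∀ {k} (t : Vector Carrier k) p → (∀ j → j ≢ p → t j ≈ ε) → sum t ≈ t p
  sum-single {suc k} t p t≈0 = begin
    sum t                             ≈⟨ sum-remove t ⟩
    t p ∙ sum (removeAt t p)          ≈⟨ ∙-congˡ (sum-cong-≋ (t≈0 _ ∘ punchInᵢ≢i p)) ⟩
    t p ∙ sum (Vector.replicate k ε)  ≈⟨ ∙-congˡ (sum-replicate-zero k) ⟩
    t p ∙ ε                           ≈⟨ identityʳ (t p) ⟩
    t p                               ∎

  sum-pair : ∀ {k} (t : Vector Carrier k) {p q} → p ≢ q →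
             (∀ j → j ≢ p → j ≢ q → t j ≈ ε) → sum t ≈ t p ∙ t q
  sum-pair {suc k} t {p} {q} p≢q t≈0 = begin
    sum t                              ≈⟨ sum-remove t ⟩
    t p ∙ sum (removeAt t p)           ≈⟨ ∙-congˡ (sum-single (removeAt t p) (punchOut p≢q) off-q) ⟩
    t p ∙ removeAt t p (punchOut p≢q)  ≡⟨ cong (t p ∙_) (removeAt-punchOut t p≢q) ⟩
    t p ∙ t q                          ∎
    where
    off-q : ∀ j → j ≢ punchOut p≢q → removeAt t p j ≈ ε
    off-q j j≢ = t≈0 _ (punchInᵢ≢i p j)
      (λ eq → j≢ (punchIn-injective p j _ (trans eq (sym (punchIn-punchOut p≢q)))))

foldr-tabulate : ∀ {A B : Set} (_∙_ : B → B → B) (ε : B) (f : A → B) {k} (g : Fin k → A) →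
                 List.foldr (λ a acc → f a ∙ acc) ε (List.tabulate g) ≡ Vector.foldr _∙_ ε (f ∘ g)
foldr-tabulate _∙_ ε f {zero}  g = refl
foldr-tabulate _∙_ ε f {suc k} g = cong (f (g zero) ∙_) (foldr-tabulate _∙_ ε f (g ∘ suc))

module XorSum where
  open import Algebra.Properties.Semiring.Sum (CommutativeRing.semiring xor-∧-commutativeRing) public
  open CommutativeMonoidSum (CommutativeRing.+-commutativeMonoid xor-∧-commutativeRing) public

module ParityCounting where
  open XorSum

  parity : ℕ → Bool
  parity zero    = false
  parity (suc n) = not (parity n)

  parity-+ : ∀ m n → parity (m ℕ.+ n) ≡ parity m xor parity n
  parity-+ zero    n = refl
  parity-+ (suc m) n = trans (cong not (parity-+ m n)) (not-distribˡ-xor (parity m) (parity n))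

  parity-sum : ∀ {k} (g : Vector ℕ k) → parity (Vector.foldr ℕ._+_ 0 g) ≡ sum (parity ∘ g)
  parity-sum {zero}  g = refl
  parity-sum {suc k} g = trans (parity-+ (g zero) _) (cong (parity (g zero) xor_) (parity-sum (g ∘ suc)))

  parity-countB : ∀ {k} (f : Fin k → Bool) → parity (countB f) ≡ sum f
  parity-countB f = begin
    parity (countB f)                         ≡⟨ cong parity (foldr-tabulate ℕ._+_ 0 indicator id) ⟩
    parity (Vector.foldr ℕ._+_ 0 indicator)   ≡⟨ parity-sum indicator ⟩
    sum (parity ∘ indicator)                  ≡⟨ sum-cong-≗ (parity-indicator ∘ f) ⟩
    sum f                                     ∎
    where
    open ≡-Reasoning
    indicator = λ j → if f j then 1 else 0
    parity-indicator : ∀ b → parity (if b then 1 else 0) ≡ b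
    parity-indicator true  = refl
    parity-indicator false = refl

  parity-odd : ∀ m → m % 2 ≡ 1 → parity m ≡ true
  parity-odd (suc zero)    _ = refl
  parity-odd (suc (suc m)) h = cong (not ∘ not) (parity-odd m h)

  xor-solveʳ : ∀ x y z → x xor y ≡ z → y ≡ x xor z
  xor-solveʳ false y z eq = eq
  xor-solveʳ true  y z eq = trans (sym (not-involutive y)) (cong not eq)

  xor≡false⇒≡ : ∀ {x y} → x xor y ≡ false → x ≡ y
  xor≡false⇒≡ {false} eq = sym eq
  xor≡false⇒≡ {true} {true} _ = refl

  module EvenSubgraph {n m} (G : Graph n m) (C : Fin m → Bool)
                      (even : ∀ v → parity (degIn G C v) ≡ false) where
    open Graph G

    coboundary : (Fin n → Bool) → Fin m → Bool
    coboundary f k = f (ends₁ k) xor f (ends₂ k)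

    incᵇ-ends₁ : ∀ k → incᵇ G k (ends₁ k) ≡ true
    incᵇ-ends₁ k = cong (_∨ does (ends₁ k ≟F ends₂ k)) (dec-true (ends₁ k ≟F ends₁ k) refl)

    incᵇ-ends₂ : ∀ k → incᵇ G k (ends₂ k) ≡ true
    incᵇ-ends₂ k = trans (cong (does (ends₂ k ≟F ends₁ k) ∨_) (dec-true (ends₂ k ≟F ends₂ k) refl)) (∨-zeroʳ _)

    incᵇ-other : ∀ k {v} → v ≢ ends₁ k → v ≢ ends₂ k → incᵇ G k v ≡ false
    incᵇ-other k {v} v≢₁ v≢₂ = cong₂ _∨_ (dec-false (v ≟F ends₁ k) v≢₁) (dec-false (v ≟F ends₂ k) v≢₂)

    sum-over-ends : ∀ (f : Fin n → Bool) k → sum (λ v → (C k ∧ incᵇ G k v) ∧ f v) ≡ C k ∧ coboundary f k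
    sum-over-ends f k = begin
      sum (λ v → (C k ∧ incᵇ G k v) ∧ f v)
        ≡⟨ sum-pair (λ v → (C k ∧ incᵇ G k v) ∧ f v) (loopless k) (λ v v≢₁ v≢₂ →
             trans (cong (λ b → (C k ∧ b) ∧ f v) (incᵇ-other k v≢₁ v≢₂)) (cong (_∧ f v) (∧-zeroʳ (C k)))) ⟩
      (C k ∧ incᵇ G k (ends₁ k)) ∧ f (ends₁ k) xor (C k ∧ incᵇ G k (ends₂ k)) ∧ f (ends₂ k)
        ≡⟨ cong₂ (λ b b′ → (C k ∧ b) ∧ f (ends₁ k) xor (C k ∧ b′) ∧ f (ends₂ k))
                 (incᵇ-ends₁ k) (incᵇ-ends₂ k) ⟩
      (C k ∧ true) ∧ f (ends₁ k) xor (C k ∧ true) ∧ f (ends₂ k)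
        ≡⟨ ∧-distribˡ-xor (C k ∧ true) (f (ends₁ k)) (f (ends₂ k)) ⟨
      (C k ∧ true) ∧ coboundary f k
        ≡⟨ cong (_∧ coboundary f k) (∧-identityʳ (C k)) ⟩
      C k ∧ coboundary f k ∎
      where open ≡-Reasoning

    handshake : ∀ f → sum (λ k → C k ∧ coboundary f k) ≡ false
    handshake f = begin
      sum (λ k → C k ∧ coboundary f k)
        ≡⟨ sum-cong-≗ (sym ∘ sum-over-ends f) ⟩
      sum (λ k → sum (λ v → (C k ∧ incᵇ G k v) ∧ f v))
        ≡⟨ ∑-comm (λ k v → (C k ∧ incᵇ G k v) ∧ f v) ⟩
      sum (λ v → sum (λ k → (C k ∧ incᵇ G k v) ∧ f v))
        ≡⟨ sum-cong-≗ (λ v → *-distribʳ-sum (f v) (λ k → C k ∧ incᵇ G k v)) ⟨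
      sum (λ v → sum (λ k → C k ∧ incᵇ G k v) ∧ f v)
        ≡⟨ sum-cong-≗ (λ v → cong (_∧ f v) (degree-even v)) ⟩
      sum {n} (λ v → false)
        ≡⟨ sum-replicate-zero n ⟩
      false ∎
      where
      open ≡-Reasoning
      degree-even : ∀ v → sum (λ k → C k ∧ incᵇ G k v) ≡ false
      degree-even v = trans (sym (parity-countB (λ k → C k ∧ incᵇ G k v))) (even v)

    module _ {i} (i∈C : C i ≡ true) (f : Fin n → Bool) where

      edge-xor : ∀ (h : Fin m → Bool) → (∀ k → C k ≡ true → k ≢ i → coboundary f k ≡ h k) →
                 coboundary f i ≡ h i xor sum (λ k → C k ∧ h k)
      edge-xor h δf≡h = xor-solveʳ (h i) (coboundary f i) (sum (λ k → C k ∧ h k)) (begin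
        h i xor coboundary f i                                ≡⟨ cong (_∧ (h i xor coboundary f i)) i∈C ⟨
        t i                                                   ≡⟨ sum-single t i t-off-i ⟨
        sum t                                                 ≡⟨ sum-cong-≗ (λ k → ∧-distribˡ-xor (C k) (h k) _) ⟩
        sum (λ k → C k ∧ h k xor C k ∧ coboundary f k)        ≡⟨ ∑-distrib-+ (λ k → C k ∧ h k) _ ⟩
        sum (λ k → C k ∧ h k) xor sum (λ k → C k ∧ coboundary f k)
                                                              ≡⟨ cong (sum (λ k → C k ∧ h k) xor_) (handshake f) ⟩
        sum (λ k → C k ∧ h k) xor false                       ≡⟨ xor-identityʳ _ ⟩
        sum (λ k → C k ∧ h k)                                 ∎)
        where
        open ≡-Reasoning
        t : Fin m → Bool
        t k = C k ∧ (h k xor coboundary f k)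
        t-off-i : ∀ k → k ≢ i → t k ≡ false
        t-off-i k k≢i with C k in k∈C
        ... | false = refl
        ... | true  = trans (cong (h k xor_) (δf≡h k k∈C k≢i)) (xor-same (h k))

      edge-invariant : (∀ k → C k ≡ true → k ≢ i → f (ends₁ k) ≡ f (ends₂ k)) → f (ends₁ i) ≡ f (ends₂ i)
      edge-invariant same = xor≡false⇒≡ (begin
        coboundary f i               ≡⟨ edge-xor (λ _ → false) (λ k k∈C k≢i → unchanged k (same k k∈C k≢i)) ⟩
        sum {m} (λ k → C k ∧ false)  ≡⟨ sum-cong-≗ (∧-zeroʳ ∘ C) ⟩
        sum {m} (λ k → false)        ≡⟨ sum-replicate-zero m ⟩
        false                        ∎)
        where
        open ≡-Reasoning
        unchanged : ∀ k → f (ends₁ k) ≡ f (ends₂ k) → coboundary f k ≡ false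
        unchanged k f₁≡f₂ = trans (cong (f (ends₁ k) xor_) (sym f₁≡f₂)) (xor-same (f (ends₁ k)))

open ParityCounting

open import Algebra.Properties.Semiring.Sum (CommutativeRing.semiring +-*-commutativeRing)
open CommutativeMonoidSum (CommutativeRing.+-commutativeMonoid +-*-commutativeRing)
open import Algebra.Properties.Group +-0-group using (inverseʳ-unique; x∙y⁻¹≈ε⇒x≈y; x≈y⇒x∙y⁻¹≈ε)

*-cancelˡ-≡0 : ∀ {p q} → p ≢ 0ℚ → p * q ≡ 0ℚ → q ≡ 0ℚ
*-cancelˡ-≡0 {p} {q} p≢0 pq≡0 = begin
  q                ≡⟨ *-identityˡ q ⟨
  1ℚ * q           ≡⟨ cong (_* q) (*-inverseˡ p) ⟨
  (1/ p * p) * q   ≡⟨ *-assoc (1/ p) p q ⟩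
  1/ p * (p * q)   ≡⟨ cong (1/ p *_) pq≡0 ⟩
  1/ p * 0ℚ        ≡⟨ *-zeroʳ (1/ p) ⟩
  0ℚ               ∎
  where
  open ≡-Reasoning
  instance _ = ℚ.≢-nonZero p≢0

sum-lincomb : ∀ {k} α β (f g : Vector ℚ k) →
              sum (λ j → α * f j + β * g j) ≡ α * sum f + β * sum g
sum-lincomb α β f g =
  trans (∑-distrib-+ (λ j → α * f j) (λ j → β * g j))
        (sym (cong₂ _+_ (*-distribˡ-sum α f) (*-distribˡ-sum β g)))

idℚ-diag : ∀ {k} (a : Fin k) → idℚ a a ≡ 1ℚ
idℚ-diag a = cong (λ b → if b then 1ℚ else 0ℚ) (dec-true (a ≟F a) refl)

idℚ-off : ∀ {k} {a b : Fin k} → a ≢ b → idℚ a b ≡ 0ℚ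
idℚ-off {a = a} {b} a≢b = cong (λ t → if t then 1ℚ else 0ℚ) (dec-false (a ≟F b) a≢b)

infixl 7 _⊙_

_⊙_ : ∀ {a b} → Vector ℚ a → (Fin a → Vector ℚ b) → Vector ℚ b
(r ⊙ A) k = sum (λ j → r j * A j k)

⊙-scale : ∀ {a b} α (r : Vector ℚ a) (A : Fin a → Vector ℚ b) →
          (λ j → α * r j) ⊙ A ≗ λ k → α * (r ⊙ A) k
⊙-scale α r A k = trans (sum-cong-≗ (λ j → *-assoc α (r j) (A j k)))
                        (sym (*-distribˡ-sum α (λ j → r j * A j k)))

⊙-sub : ∀ {a b} (r s : Vector ℚ a) (A : Fin a → Vector ℚ b) →
        (λ j → r j - s j) ⊙ A ≗ λ k → (r ⊙ A) k - (s ⊙ A) k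
⊙-sub r s A k = begin
  sum (λ j → (r j - s j) * A j k)
    ≡⟨ sum-cong-≗ (λ j → split (r j) (s j) (A j k)) ⟩
  sum (λ j → 1ℚ * (r j * A j k) + - 1ℚ * (s j * A j k))
    ≡⟨ sum-lincomb 1ℚ (- 1ℚ) (λ j → r j * A j k) (λ j → s j * A j k) ⟩
  1ℚ * (r ⊙ A) k + - 1ℚ * (s ⊙ A) k
    ≡⟨ split′ ((r ⊙ A) k) ((s ⊙ A) k) ⟩
  (r ⊙ A) k - (s ⊙ A) k ∎
  where
  open ≡-Reasoning
  open +-*-Solver
  split : ∀ x y z → (x - y) * z ≡ 1ℚ * (x * z) + - 1ℚ * (y * z)
  split = solve 3 (λ x y z → (x :- y) :* z := con 1ℚ :* (x :* z) :+ (:- con 1ℚ) :* (y :* z)) refl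
  split′ : ∀ x y → 1ℚ * x + - 1ℚ * y ≡ x - y
  split′ = solve 2 (λ x y → con 1ℚ :* x :+ (:- con 1ℚ) :* y := x :- y) refl

⊙-assoc : ∀ {a b c} (r : Vector ℚ a) (M : Fin a → Vector ℚ b) (A : Fin b → Vector ℚ c) →
          (r ⊙ M) ⊙ A ≗ r ⊙ (λ ℓ → M ℓ ⊙ A)
⊙-assoc r M A k = begin
  sum (λ t → sum (λ ℓ → r ℓ * M ℓ t) * A t k)
    ≡⟨ sum-cong-≗ (λ t → *-distribʳ-sum (A t k) (λ ℓ → r ℓ * M ℓ t)) ⟩
  sum (λ t → sum (λ ℓ → (r ℓ * M ℓ t) * A t k))
    ≡⟨ sum-cong-≗ (λ t → sum-cong-≗ (λ ℓ → *-assoc (r ℓ) (M ℓ t) (A t k))) ⟩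
  sum (λ t → sum (λ ℓ → r ℓ * (M ℓ t * A t k)))
    ≡⟨ ∑-comm (λ t ℓ → r ℓ * (M ℓ t * A t k)) ⟩
  sum (λ ℓ → sum (λ t → r ℓ * (M ℓ t * A t k)))
    ≡⟨ sum-cong-≗ (λ ℓ → *-distribˡ-sum (r ℓ) (λ t → M ℓ t * A t k)) ⟨
  sum (λ ℓ → r ℓ * (M ℓ ⊙ A) k) ∎
  where open ≡-Reasoning

⊙-identityʳ : ∀ {a} (r : Vector ℚ a) → r ⊙ idℚ ≗ r
⊙-identityʳ r k = begin
  sum (λ j → r j * idℚ j k)  ≡⟨ sum-single (λ j → r j * idℚ j k) k off-diagonal ⟩
  r k * idℚ k k              ≡⟨ cong (r k *_) (idℚ-diag k) ⟩
  r k * 1ℚ                   ≡⟨ *-identityʳ (r k) ⟩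
  r k                        ∎
  where
  open ≡-Reasoning
  off-diagonal : ∀ j → j ≢ k → r j * idℚ j k ≡ 0ℚ
  off-diagonal j j≢k = trans (cong (r j *_) (idℚ-off j≢k)) (*-zeroʳ (r j))

⊙-identityˡ : ∀ {a b} (A : Fin a → Vector ℚ b) i → idℚ i ⊙ A ≗ A i
⊙-identityˡ A i k = begin
  sum (λ j → idℚ i j * A j k)  ≡⟨ sum-single (λ j → idℚ i j * A j k) i off-diagonal ⟩
  idℚ i i * A i k              ≡⟨ cong (_* A i k) (idℚ-diag i) ⟩
  1ℚ * A i k                   ≡⟨ *-identityˡ (A i k) ⟩
  A i k                        ∎
  where
  open ≡-Reasoning
  off-diagonal : ∀ j → j ≢ i → idℚ i j * A j k ≡ 0ℚ
  off-diagonal j j≢i = trans (cong (_* A j k) (idℚ-off (j≢i ∘ sym))) (*-zeroˡ (A j k))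

Dependence : ∀ {k m} → (Fin k → Vector ℚ m) → Set
Dependence {k} v = Σ[ c ∈ Vector ℚ k ] (∃ λ j → c j ≢ 0ℚ) × (c ⊙ v ≗ const 0ℚ)

dependence-of-zero-column : ∀ {k m} (v : Fin k → Vector ℚ (suc m)) →
                            (∀ j → v j zero ≡ 0ℚ) → Dependence (Vector.tail ∘ v) → Dependence v
dependence-of-zero-column {k} v zero-column (c , nonzero , c⊙v≡0) = c , nonzero , λ where
  zero      → trans (sum-cong-≗ (λ j → trans (cong (c j *_) (zero-column j)) (*-zeroʳ (c j))))
                    (sum-replicate-zero k)
  (suc col) → c⊙v≡0 col

eliminate-pivot : ∀ {k m} → (Fin (suc k) → Vector ℚ (suc m)) → Fin (suc k) → Fin k → Vector ℚ m
eliminate-pivot v p j col = v p zero * v (punchIn p j) (suc col) - v (punchIn p j) zero * v p (suc col)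

dependence-of-pivot : ∀ {k m} (v : Fin (suc k) → Vector ℚ (suc m)) p → v p zero ≢ 0ℚ →
                      Dependence (eliminate-pivot v p) → Dependence v
dependence-of-pivot {k} v p π≢0 (d , (j , dj≢0) , d⊙w≡0) = c , (punchIn p j , cj≢0) , c⊙v≡0
  where
  open ≡-Reasoning
  open +-*-Solver
  π = v p zero
  u = removeAt v p
  S = d ⊙ u
  c : Vector ℚ (suc k)
  c = insertAt (λ j → π * d j) p (- S zero)
  cj≢0 : c (punchIn p j) ≢ 0ℚ
  cj≢0 eq = dj≢0 (*-cancelˡ-≡0 π≢0 (trans (sym (insertAt-punchIn _ p _ j)) eq))
  c⊙v : ∀ col → (c ⊙ v) col ≡ - S zero * v p col + π * S col
  c⊙v col = begin
    sum (λ ℓ → c ℓ * v ℓ col)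
      ≡⟨ sum-remove (λ ℓ → c ℓ * v ℓ col) ⟩
    c p * v p col + sum (λ j → c (punchIn p j) * u j col)
      ≡⟨ cong₂ _+_ (cong (_* v p col) (insertAt-lookup _ p _))
                   (trans (sum-cong-≗ (λ j → cong (_* u j col) (removeAt-insertAt _ p _ j)))
                          (⊙-scale π d u col)) ⟩
    - S zero * v p col + π * S col ∎
  eliminated : ∀ col → (d ⊙ eliminate-pivot v p) col ≡ π * S (suc col) + - v p (suc col) * S zero
  eliminated col = trans (sum-cong-≗ (λ j → regroup (d j) π (u j (suc col)) (u j zero) (v p (suc col))))
                         (sum-lincomb π (- v p (suc col)) (λ j → d j * u j (suc col)) (λ j → d j * u j zero))
    where
    regroup : ∀ δ π x a β → δ * (π * x - a * β) ≡ π * (δ * x) + - β * (δ * a)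
    regroup = solve 5 (λ δ π x a β → δ :* (π :* x :- a :* β) := π :* (δ :* x) :+ (:- β) :* (δ :* a)) refl
  c⊙v≡0 : c ⊙ v ≗ const 0ℚ
  c⊙v≡0 zero = trans (c⊙v zero) (solve 2 (λ s π → (:- s) :* π :+ π :* s := con 0ℚ) refl (S zero) π)
  c⊙v≡0 (suc col) = begin
    (c ⊙ v) (suc col)                                ≡⟨ c⊙v (suc col) ⟩
    - S zero * v p (suc col) + π * S (suc col)       ≡⟨ swap (S zero) (v p (suc col)) π (S (suc col)) ⟩
    π * S (suc col) + - v p (suc col) * S zero       ≡⟨ eliminated col ⟨
    (d ⊙ eliminate-pivot v p) col                    ≡⟨ d⊙w≡0 col ⟩
    0ℚ                                               ∎
    where
    swap : ∀ s β π t → - s * β + π * t ≡ π * t + - β * s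
    swap = solve 4 (λ s β π t → (:- s) :* β :+ π :* t := π :* t :+ (:- β) :* s) refl

dependent : ∀ {k m} → m ℕ.< k → (v : Fin k → Vector ℚ m) → Dependence v
dependent {suc k} {zero}  _         v = const 1ℚ , (zero , λ ()) , λ ()
dependent {suc k} {suc m} (s≤s m<k) v with any? (λ p → ¬? (v p zero ≟ 0ℚ))
... | yes (p , π≢0) = dependence-of-pivot v p π≢0 (dependent m<k (eliminate-pivot v p))
... | no  no-pivot  = dependence-of-zero-column v zero-column (dependent (m<n⇒m<1+n m<k) (Vector.tail ∘ v))
  where
  zero-column : ∀ j → v j zero ≡ 0ℚ
  zero-column j = decidable-stable (v j zero ≟ 0ℚ) (λ v≢0 → no-pivot (j , v≢0))

TrivialLeftKernel : ∀ {a b} → (Fin a → Vector ℚ b) → Set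
TrivialLeftKernel A = ∀ r → r ⊙ A ≗ const 0ℚ → r ≗ const 0ℚ

⊙-injective : ∀ {a b} (A : Fin a → Vector ℚ b) → TrivialLeftKernel A →
              ∀ {r s} → r ⊙ A ≗ s ⊙ A → r ≗ s
⊙-injective A ker {r} {s} r⊙A≗s⊙A j =
  x∙y⁻¹≈ε⇒x≈y (r j) (s j)
    (ker (λ j → r j - s j) (λ k → trans (⊙-sub r s A k) (x≈y⇒x∙y⁻¹≈ε (r⊙A≗s⊙A k))) j)

-- The n + 1 vectors idℚ i, A 0, …, A (n - 1) of ℚⁿ are dependent, and the coefficient of idℚ i
-- is nonzero because the rows of A are independent; solving for idℚ i gives the row.
left-inverse-row : ∀ {n} (A : Fin n → Vector ℚ n) → TrivialLeftKernel A →
                   ∀ i → Σ[ x ∈ Vector ℚ n ] x ⊙ A ≗ idℚ i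
left-inverse-row {n} A ker i = row (dependent (n<1+n n) (idℚ i ∷ A))
  where
  row : Dependence (idℚ i ∷ A) → Σ[ x ∈ Vector ℚ n ] x ⊙ A ≗ idℚ i
  row (c , (j , cj≢0) , c⊙v≡0) = (λ ℓ → - (1/ c zero) * c (suc ℓ)) , row-eq
    where
    open ≡-Reasoning
    open +-*-Solver
    tail⊙A : ∀ k → (Vector.tail c ⊙ A) k ≡ - (c zero * idℚ i k)
    tail⊙A k = inverseʳ-unique (c zero * idℚ i k) ((Vector.tail c ⊙ A) k) (c⊙v≡0 k)
    vanishes : c zero ≡ 0ℚ → c ≗ const 0ℚ
    vanishes c₀≡0 zero    = c₀≡0
    vanishes c₀≡0 (suc ℓ) = ker (Vector.tail c) (λ k → trans (tail⊙A k)
                              (cong -_ (trans (cong (_* idℚ i k) c₀≡0) (*-zeroˡ (idℚ i k))))) ℓ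
    c₀≢0 : c zero ≢ 0ℚ
    c₀≢0 c₀≡0 = cj≢0 (vanishes c₀≡0 j)
    instance _ = ℚ.≢-nonZero c₀≢0
    row-eq : (λ ℓ → - (1/ c zero) * c (suc ℓ)) ⊙ A ≗ idℚ i
    row-eq k = begin
      ((λ ℓ → - (1/ c zero) * c (suc ℓ)) ⊙ A) k   ≡⟨ ⊙-scale (- (1/ c zero)) (Vector.tail c) A k ⟩
      - (1/ c zero) * (Vector.tail c ⊙ A) k       ≡⟨ cong (- (1/ c zero) *_) (tail⊙A k) ⟩
      - (1/ c zero) * - (c zero * idℚ i k)        ≡⟨ regroup (1/ c zero) (c zero) (idℚ i k) ⟩
      (1/ c zero * c zero) * idℚ i k              ≡⟨ cong (_* idℚ i k) (*-inverseˡ (c zero)) ⟩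
      1ℚ * idℚ i k                                ≡⟨ *-identityˡ (idℚ i k) ⟩
      idℚ i k                                     ∎
      where
      regroup : ∀ u c δ → - u * - (c * δ) ≡ (u * c) * δ
      regroup = solve 3 (λ u c δ → (:- u) :* (:- (c :* δ)) := (u :* c) :* δ) refl

invertible : ∀ {n} (A : Fin n → Vector ℚ n) → TrivialLeftKernel A →
             Σ[ M ∈ (Fin n → Vector ℚ n) ] (∀ i → M i ⊙ A ≗ idℚ i) × (∀ a → A a ⊙ M ≗ idℚ a)
invertible A ker = M , left , right
  where
  M = λ i → proj₁ (left-inverse-row A ker i)
  left = λ i → proj₂ (left-inverse-row A ker i)
  right : ∀ a → A a ⊙ M ≗ idℚ a
  right a = ⊙-injective A ker λ k → begin
    ((A a ⊙ M) ⊙ A) k            ≡⟨ ⊙-assoc (A a) M A k ⟩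
    (A a ⊙ (λ ℓ → M ℓ ⊙ A)) k    ≡⟨ sum-cong-≗ (λ ℓ → cong (A a ℓ *_) (left ℓ k)) ⟩
    (A a ⊙ idℚ) k                ≡⟨ ⊙-identityʳ (A a) k ⟩
    A a k                        ≡⟨ ⊙-identityˡ A a k ⟨
    (idℚ a ⊙ A) k                ∎
    where open ≡-Reasoning

signℚ-* : ∀ s t → signℚ (s Sign.* t) ≡ signℚ s * signℚ t
signℚ-* Sign.+ Sign.+ = refl
signℚ-* Sign.+ Sign.- = refl
signℚ-* Sign.- Sign.+ = refl
signℚ-* Sign.- Sign.- = refl

signℚ-square : ∀ s → signℚ s * signℚ s ≡ 1ℚ
signℚ-square Sign.+ = refl
signℚ-square Sign.- = refl

signℚ-opposite : ∀ s → signℚ (Sign.opposite s) ≡ - signℚ s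
signℚ-opposite Sign.+ = refl
signℚ-opposite Sign.- = refl

signℚ-flip : ∀ s {y z} → y ≡ signℚ s * z → z ≡ signℚ s * y
signℚ-flip s {y} {z} y≡sz = begin
  z                         ≡⟨ *-identityˡ z ⟨
  1ℚ * z                    ≡⟨ cong (_* z) (signℚ-square s) ⟨
  (signℚ s * signℚ s) * z   ≡⟨ *-assoc (signℚ s) (signℚ s) z ⟩
  signℚ s * (signℚ s * z)   ≡⟨ cong (signℚ s *_) y≡sz ⟨
  signℚ s * y               ∎
  where open ≡-Reasoning

signℚ-*-zero : ∀ s {y} → signℚ s * y ≡ 0ℚ → y ≡ 0ℚ
signℚ-*-zero s {y} sy≡0 = trans (signℚ-flip s (sym sy≡0)) (*-zeroʳ (signℚ s))

isNegᵇ-* : ∀ s t → isNegᵇ (s Sign.* t) ≡ isNegᵇ s xor isNegᵇ t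
isNegᵇ-* Sign.+ Sign.+ = refl
isNegᵇ-* Sign.+ Sign.- = refl
isNegᵇ-* Sign.- Sign.+ = refl
isNegᵇ-* Sign.- Sign.- = refl

-x≡x⇒x≡0 : ∀ {y} → - y ≡ y → y ≡ 0ℚ
-x≡x⇒x≡0 {y} -y≡y = begin
  y              ≡⟨ solve 1 (λ y → y := con ½ :* (y :+ y)) refl y ⟩
  ½ * (y + y)    ≡⟨ cong (λ t → ½ * (t + y)) -y≡y ⟨
  ½ * (- y + y)  ≡⟨ cong (½ *_) (+-inverseˡ y) ⟩
  0ℚ             ∎
  where
  open ≡-Reasoning
  open +-*-Solver

does-signℚ : ∀ s {y} → y ≢ 0ℚ → does (signℚ s * y ≟ y) ≡ not (isNegᵇ s)
does-signℚ Sign.+ {y} _   = dec-true (1ℚ * y ≟ y) (*-identityˡ y)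
does-signℚ Sign.- {y} y≢0 = dec-false (- 1ℚ * y ≟ y) (y≢0 ∘ -x≡x⇒x≡0 ∘ trans (-1* y))
  where
  -1* : ∀ y → - y ≡ - 1ℚ * y
  -1* = solve 1 (λ y → :- y := (:- con 1ℚ) :* y) refl
    where open +-*-Solver

x≡-x+a⇒x≡½a : ∀ {x a} → x ≡ - x + a → x ≡ ½ * a
x≡-x+a⇒x≡½a {x} {a} x≡-x+a = begin
  x                  ≡⟨ solve 1 (λ x → x := con ½ :* (x :+ x)) refl x ⟩
  ½ * (x + x)        ≡⟨ cong (λ t → ½ * (t + x)) x≡-x+a ⟩
  ½ * ((- x + a) + x) ≡⟨ solve 2 (λ x a → con ½ :* (((:- x) :+ a) :+ x) := con ½ :* a) refl x a ⟩
  ½ * a              ∎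
  where
  open ≡-Reasoning
  open +-*-Solver

solve-column : ∀ {x₁ x₂ a₁ a₂ s e} → a₁ * a₂ ≡ - s → a₂ * a₂ ≡ 1ℚ →
               x₁ * a₁ + x₂ * a₂ ≡ e → x₂ ≡ s * x₁ + a₂ * e
solve-column {x₁} {x₂} {a₁} {a₂} {s} {e} a₁a₂ a₂a₂ column = sym (begin
  s * x₁ + a₂ * e                             ≡⟨ cong (λ t → s * x₁ + a₂ * t) column ⟨
  s * x₁ + a₂ * (x₁ * a₁ + x₂ * a₂)           ≡⟨ expand s x₁ x₂ a₁ a₂ ⟩
  s * x₁ + x₁ * (a₁ * a₂) + x₂ * (a₂ * a₂)    ≡⟨ cong₂ (λ p q → s * x₁ + x₁ * p + x₂ * q) a₁a₂ a₂a₂ ⟩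
  s * x₁ + x₁ * - s + x₂ * 1ℚ                 ≡⟨ cancel s x₁ x₂ ⟩
  x₂                                          ∎)
  where
  open ≡-Reasoning
  open +-*-Solver
  expand : ∀ s x₁ x₂ a₁ a₂ → s * x₁ + a₂ * (x₁ * a₁ + x₂ * a₂) ≡ s * x₁ + x₁ * (a₁ * a₂) + x₂ * (a₂ * a₂)
  expand = solve 5 (λ s x₁ x₂ a₁ a₂ → s :* x₁ :+ a₂ :* (x₁ :* a₁ :+ x₂ :* a₂)
                                    := s :* x₁ :+ x₁ :* (a₁ :* a₂) :+ x₂ :* (a₂ :* a₂)) refl
  cancel : ∀ s x₁ x₂ → s * x₁ + x₁ * - s + x₂ * 1ℚ ≡ x₂
  cancel = solve 3 (λ s x₁ x₂ → s :* x₁ :+ x₁ :* (:- s) :+ x₂ :* con 1ℚ := x₂) refl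

signℚ-flip′ : ∀ s {y z} → y ≡ - signℚ s * z → z ≡ - signℚ s * y
signℚ-flip′ s rewrite sym (signℚ-opposite s) = signℚ-flip (Sign.opposite s)

half-solution : ∀ s {x x′ a} → x′ ≡ - signℚ s * x → x ≡ signℚ s * x′ + a * 1ℚ → x ≡ ½ * a
half-solution s {x} {x′} {a} x′≡-sx x≡sx′+a = x≡-x+a⇒x≡½a (begin
  x                                          ≡⟨ x≡sx′+a ⟩
  signℚ s * x′ + a * 1ℚ                      ≡⟨ cong (λ t → signℚ s * t + a * 1ℚ) x′≡-sx ⟩
  signℚ s * (- signℚ s * x) + a * 1ℚ         ≡⟨ regroup (signℚ s) x a ⟩
  - ((signℚ s * signℚ s) * x) + a            ≡⟨ cong (λ t → - (t * x) + a) (signℚ-square s) ⟩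
  - (1ℚ * x) + a                             ≡⟨ cong (λ t → - t + a) (*-identityˡ x) ⟩
  - x + a                                    ∎)
  where
  open ≡-Reasoning
  open +-*-Solver
  regroup : ∀ s x a → s * (- s * x) + a * 1ℚ ≡ - ((s * s) * x) + a
  regroup = solve 3 (λ s x a → s :* ((:- s) :* x) :+ a :* con 1ℚ := :- ((s :* s) :* x) :+ a) refl

other-endpoint-zero : ∀ s {x′ a} → x′ ≡ 0ℚ → signℚ s * x′ + a * 1ℚ ≡ a
other-endpoint-zero s {x′} {a} x′≡0 = begin
  signℚ s * x′ + a * 1ℚ     ≡⟨ cong₂ (λ t u → signℚ s * t + u) x′≡0 (*-identityʳ a) ⟩
  signℚ s * 0ℚ + a          ≡⟨ cong (_+ a) (*-zeroʳ (signℚ s)) ⟩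
  0ℚ + a                    ≡⟨ +-identityˡ a ⟩
  a                         ∎
  where open ≡-Reasoning

module Walks {n m} (G : Graph n m) where
  open Graph G

  infixr 5 _++_

  _++_ : ∀ {S a b c} → Walk G S a b → Walk G S b c → Walk G S a c
  []             ++ w′ = w′
  step e s J w   ++ w′ = step e s J (w ++ w′)

  joins-inc : ∀ {e a c} → Joins G e a c → Inc G e c
  joins-inc (inj₁ (_ , e₂≡c)) = inj₂ (sym e₂≡c)
  joins-inc (inj₂ (_ , e₁≡c)) = inj₁ (sym e₁≡c)

  walk-invariant : ∀ {B : Set} (f : Fin n → B) {S} → (∀ k → S k → f (ends₁ k) ≡ f (ends₂ k)) →
                   ∀ {a b} → Walk G S a b → f a ≡ f b
  walk-invariant f same []                                 = refl
  walk-invariant f same (step e s (inj₁ (refl , refl)) w) = trans (same e s) (walk-invariant f same w)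
  walk-invariant f same (step e s (inj₂ (refl , refl)) w) = trans (sym (same e s)) (walk-invariant f same w)

  third-endpoint : ∀ {i u v z} → Inc G i u → Inc G i v → Inc G i z → u ≢ z → v ≢ z → u ≡ v
  third-endpoint (inj₁ refl) (inj₁ refl) _           _   _   = refl
  third-endpoint (inj₂ refl) (inj₂ refl) _           _   _   = refl
  third-endpoint (inj₁ refl) (inj₂ refl) (inj₁ refl) u≢z _   = ⊥-elim (u≢z refl)
  third-endpoint (inj₁ refl) (inj₂ refl) (inj₂ refl) _   v≢z = ⊥-elim (v≢z refl)
  third-endpoint (inj₂ refl) (inj₁ refl) (inj₁ refl) _   v≢z = ⊥-elim (v≢z refl)
  third-endpoint (inj₂ refl) (inj₁ refl) (inj₂ refl) u≢z _   = ⊥-elim (u≢z refl)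

module SignedGraph {n m} (G : Graph n m) (σ : Fin m → Sign) where
  open Graph G

  SignConsistent : (Fin n → ℚ) → Fin m → Set
  SignConsistent x k = x (ends₂ k) ≡ signℚ (σ k) * x (ends₁ k)

  consistent-joins : ∀ {x e a c} → SignConsistent x e → Joins G e a c → x c ≡ signℚ (σ e) * x a
  consistent-joins consistent (inj₁ (refl , refl)) = consistent
  consistent-joins {e = e} consistent (inj₂ (refl , refl)) = signℚ-flip (σ e) consistent

  consistent-walk : ∀ {S x} → (∀ k → S k → SignConsistent x k) →
                    ∀ {a b} (w : Walk G S a b) → x b ≡ signℚ (sgn G σ w) * x a
  consistent-walk         consistent []             = sym (*-identityˡ _)
  consistent-walk {x = x} consistent {a} (step e s J w) = begin
    x _                                   ≡⟨ consistent-walk consistent w ⟩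
    signℚ (sgn G σ w) * x _               ≡⟨ cong (signℚ (sgn G σ w) *_) (consistent-joins (consistent e s) J) ⟩
    signℚ (sgn G σ w) * (signℚ (σ e) * x a)
                                          ≡⟨ *-assoc (signℚ (sgn G σ w)) (signℚ (σ e)) (x a) ⟨
    (signℚ (sgn G σ w) * signℚ (σ e)) * x a
                                          ≡⟨ cong (_* x a) (*-comm (signℚ (sgn G σ w)) (signℚ (σ e))) ⟩
    (signℚ (σ e) * signℚ (sgn G σ w)) * x a
                                          ≡⟨ cong (_* x a) (signℚ-* (σ e) (sgn G σ w)) ⟨
    signℚ (σ e Sign.* sgn G σ w) * x a    ∎
    where open ≡-Reasoning

  last-crossing : ∀ i {a b} → Walk G (λ _ → ⊤) a b →
                  Walk G (Avoid G σ i) a b ⊎ (∃ λ z → Inc G i z × Walk G (Avoid G σ i) z b)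
  last-crossing i [] = inj₁ []
  last-crossing i (step e _ J w) with last-crossing i w
  ... | inj₂ crossing = inj₂ crossing
  ... | inj₁ w′ with e ≟F i
  ...   | yes refl = inj₂ (_ , Walks.joins-inc G J , w′)
  ...   | no  e≢i  = inj₁ (step e e≢i J w′)

IsUnit : ℤ → Set
IsUnit ν = ν ≡ ℤ.1ℤ ⊎ ν ≡ ℤ.-1ℤ

unit-square : ∀ {ν} → IsUnit ν → toℚ ν * toℚ ν ≡ 1ℚ
unit-square (inj₁ refl) = refl
unit-square (inj₂ refl) = refl

unit-product : ∀ s {ν ν′} → IsUnit ν → IsUnit ν′ →
               (s ≡ Sign.- → ν ≡ ν′) → (s ≡ Sign.+ → ν ≡ ℤ.- ν′) → toℚ ν * toℚ ν′ ≡ - signℚ s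
unit-product Sign.+ (inj₁ refl) (inj₁ refl) _     opposite = contradiction (opposite refl) λ ()
unit-product Sign.+ (inj₁ refl) (inj₂ refl) _     _        = refl
unit-product Sign.+ (inj₂ refl) (inj₁ refl) _     _        = refl
unit-product Sign.+ (inj₂ refl) (inj₂ refl) _     opposite = contradiction (opposite refl) λ ()
unit-product Sign.- (inj₁ refl) (inj₁ refl) _     _        = refl
unit-product Sign.- (inj₁ refl) (inj₂ refl) equal _        = contradiction (equal refl) λ ()
unit-product Sign.- (inj₂ refl) (inj₁ refl) equal _        = contradiction (equal refl) λ ()
unit-product Sign.- (inj₂ refl) (inj₂ refl) _     _        = refl

weight-of-equal-units : ∀ {ν ν′} → ν ≡ ν′ → IsUnit ν →
                        toℚ ν ≡ (if does (ν ℤ.≟ ℤ.-1ℤ) ∧ does (ν′ ℤ.≟ ℤ.-1ℤ) then - 1ℚ else 1ℚ)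
weight-of-equal-units refl (inj₁ refl) = refl
weight-of-equal-units refl (inj₂ refl) = refl

sign-cases : ∀ s → s ≡ Sign.+ ⊎ s ≡ Sign.-
sign-cases Sign.+ = inj₁ refl
sign-cases Sign.- = inj₂ refl

module Incidence {n m} (G : Graph n m) (σ : Fin m → Sign) (N : Fin n → Fin m → ℤ)
                 (I : IsIncidence G σ N) where
  open Graph G
  open SignedGraph G σ
  open Walks G

  A : Fin n → Fin m → ℚ
  A j k = toℚ (N j k)

  module _ (k : Fin m) where
    private
      a₁ = A (ends₁ k) k
      a₂ = A (ends₂ k) k
      unit₁ = proj₁ (proj₂ (I k))
      unit₂ = proj₁ (proj₂ (proj₂ (I k)))

    entries-product : a₁ * a₂ ≡ - signℚ (σ k)
    entries-product = unit-product (σ k) unit₁ unit₂ (proj₁ (proj₂ (proj₂ (proj₂ (I k)))))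
                                                     (proj₂ (proj₂ (proj₂ (proj₂ (I k)))))

    ⊙-column : ∀ x → (x ⊙ A) k ≡ x (ends₁ k) * a₁ + x (ends₂ k) * a₂
    ⊙-column x = sum-pair (λ j → x j * A j k) (loopless k) λ j j≢₁ j≢₂ →
      trans (cong (λ ν → x j * toℚ ν) (proj₁ (I k) j [ j≢₁ , j≢₂ ])) (*-zeroʳ (x j))

    column-equation₂ : ∀ x {e} → (x ⊙ A) k ≡ e → x (ends₂ k) ≡ signℚ (σ k) * x (ends₁ k) + a₂ * e
    column-equation₂ x column = solve-column entries-product (unit-square unit₂) (trans (sym (⊙-column x)) column)

    column-equation₁ : ∀ x {e} → (x ⊙ A) k ≡ e → x (ends₁ k) ≡ signℚ (σ k) * x (ends₂ k) + a₁ * e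
    column-equation₁ x column =
      solve-column (trans (*-comm a₂ a₁) entries-product) (unit-square unit₁)
                   (trans (+-comm (x (ends₂ k) * a₂) (x (ends₁ k) * a₁)) (trans (sym (⊙-column x)) column))

    orthogonal⇒consistent : ∀ x → (x ⊙ A) k ≡ 0ℚ → SignConsistent x k
    orthogonal⇒consistent x orthogonal = begin
      x (ends₂ k)                                 ≡⟨ column-equation₂ x orthogonal ⟩
      signℚ (σ k) * x (ends₁ k) + a₂ * 0ℚ         ≡⟨ cong (signℚ (σ k) * x (ends₁ k) +_) (*-zeroʳ a₂) ⟩
      signℚ (σ k) * x (ends₁ k) + 0ℚ              ≡⟨ +-identityʳ (signℚ (σ k) * x (ends₁ k)) ⟩
      signℚ (σ k) * x (ends₁ k)                   ∎
      where open ≡-Reasoning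

  module _ (i : Fin m) where
    private
      T = tail G σ N i
      H = head G σ N i
      W = wt G σ N i

    tail-head : (T ≡ ends₁ i × H ≡ ends₂ i) ⊎ (T ≡ ends₂ i × H ≡ ends₁ i)
    tail-head with σ i
    ... | Sign.+ with does (N (ends₁ i) i ℤ.≟ ℤ.1ℤ)
    ...   | true  = inj₁ (refl , refl)
    ...   | false = inj₂ (refl , refl)
    tail-head | Sign.- with does (toℕ (ends₁ i) ℕ.<? toℕ (ends₂ i))
    ...   | true  = inj₁ (refl , refl)
    ...   | false = inj₂ (refl , refl)

    weight-positive : σ i ≡ Sign.+ → W ≡ 1ℚ
    weight-positive σ≡+ with σ i
    weight-positive refl | Sign.+ = refl

    positive-entries : σ i ≡ Sign.+ → A T i ≡ 1ℚ × A H i ≡ - 1ℚ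
    positive-entries σ≡+ with I i
    ... | _ , unit₁ , unit₂ , _ , opposite with σ i
    positive-entries refl | _ , unit₁ , unit₂ , _ , opposite | Sign.+ with N (ends₁ i) i ℤ.≟ ℤ.1ℤ
    ... | yes e₁≡1 = cong toℚ e₁≡1 , cong toℚ e₂≡-1
      where
      e₂≡-1 : N (ends₂ i) i ≡ ℤ.-1ℤ
      e₂≡-1 = trans (sym (neg-involutive _)) (cong ℤ.-_ (trans (sym (opposite refl)) e₁≡1))
    ... | no  e₁≢1 with unit₁ | unit₂
    ...   | inj₁ e₁≡1  | _           = ⊥-elim (e₁≢1 e₁≡1)
    ...   | inj₂ e₁≡-1 | inj₁ e₂≡1   = cong toℚ e₂≡1 , cong toℚ e₁≡-1
    ...   | inj₂ e₁≡-1 | inj₂ e₂≡-1  =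
      contradiction (trans (sym e₁≡-1) (trans (opposite refl) (cong ℤ.-_ e₂≡-1))) λ ()

    negative-entries : σ i ≡ Sign.- → ∀ {u} → Inc G i u → A u i ≡ W
    negative-entries σ≡- u-inc with I i
    ... | _ , unit₁ , _ , equal , _ with σ i
    negative-entries refl (inj₁ refl) | _ , unit₁ , _ , equal , _ | Sign.- =
      weight-of-equal-units (equal refl) unit₁
    negative-entries refl (inj₂ refl) | _ , unit₁ , _ , equal , _ | Sign.- =
      trans (cong toℚ (sym (equal refl))) (weight-of-equal-units (equal refl) unit₁)

    tail-inc : Inc G i T
    tail-inc with tail-head
    ... | inj₁ (T≡₁ , _) = inj₁ T≡₁
    ... | inj₂ (T≡₂ , _) = inj₂ T≡₂

    head-inc : Inc G i H
    head-inc with tail-head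
    ... | inj₁ (_ , H≡₂) = inj₂ H≡₂
    ... | inj₂ (_ , H≡₁) = inj₁ H≡₁

    tail≢head : T ≢ H
    tail≢head T≡H with tail-head
    ... | inj₁ (T≡₁ , H≡₂) = loopless i (trans (sym T≡₁) (trans T≡H H≡₂))
    ... | inj₂ (T≡₂ , H≡₁) = loopless i (trans (sym H≡₁) (trans (sym T≡H) T≡₂))

    endpoint-entry : ∀ {u} → Inc G i u → (σ i ≡ Sign.+ → u ≢ H) → A u i ≡ W
    endpoint-entry u-inc not-head with sign-cases (σ i)
    ... | inj₂ σ≡- = negative-entries σ≡- u-inc
    ... | inj₁ σ≡+ = begin
      A _ i    ≡⟨ cong (λ v → A v i) (third-endpoint u-inc tail-inc head-inc (not-head σ≡+) tail≢head) ⟩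
      A T i    ≡⟨ proj₁ (positive-entries σ≡+) ⟩
      1ℚ       ≡⟨ weight-positive σ≡+ ⟨
      W        ∎
      where open ≡-Reasoning

infix 4 _≈±_ _≈±?_

_≈±_ : ℚ → ℚ → Set
z ≈± y = ∃ λ s → z ≡ signℚ s * y

_≈±?_ : ∀ z y → Dec (z ≈± y)
z ≈±? y with z ≟ signℚ Sign.+ * y | z ≟ signℚ Sign.- * y
... | yes z≡y | _        = yes (Sign.+ , z≡y)
... | no _    | yes z≡-y = yes (Sign.- , z≡-y)
... | no z≢y  | no z≢-y  = no λ where
  (Sign.+ , z≡y)  → z≢y z≡y
  (Sign.- , z≡-y) → z≢-y z≡-y

≈±-refl : ∀ y → y ≈± y
≈±-refl y = Sign.+ , sym (*-identityˡ y)

≈±-sign : ∀ t {z y} → z ≈± y → signℚ t * z ≈± y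
≈±-sign t {z} {y} (s , z≡sy) = t Sign.* s , (begin
  signℚ t * z                ≡⟨ cong (signℚ t *_) z≡sy ⟩
  signℚ t * (signℚ s * y)    ≡⟨ *-assoc (signℚ t) (signℚ s) y ⟨
  (signℚ t * signℚ s) * y    ≡⟨ cong (_* y) (signℚ-* t s) ⟨
  signℚ (t Sign.* s) * y     ∎)
  where open ≡-Reasoning

does-≈±-sign : ∀ t z y → does (signℚ t * z ≈±? y) ≡ does (z ≈±? y)
does-≈±-sign t z y = does-⇔ (mk⇔ unsign (≈±-sign t)) (signℚ t * z ≈±? y) (z ≈±? y)
  where
  unsign : signℚ t * z ≈± y → z ≈± y
  unsign tz≈±y = subst (_≈± y) (sym (signℚ-flip t refl)) (≈±-sign t tz≈±y)

does≡true⇒ : ∀ {P : Set} (d : Dec P) → does d ≡ true → P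
does≡true⇒ (yes p) _  = p
does≡true⇒ (no _)  ()

opposite-signs : ∀ s t → not (isNegᵇ t) ≡ isNegᵇ s → signℚ t ≡ - signℚ s
opposite-signs Sign.+ Sign.- _ = refl
opposite-signs Sign.- Sign.+ _ = refl

xor-cancel-around : ∀ a b → a xor (b xor a) ≡ b
xor-cancel-around false b = xor-identityʳ b
xor-cancel-around true  b = trans (cong not (xor-comm b true)) (not-involutive b)

module UnbalancedCycle {n m} (G : Graph n m) (σ : Fin m → Sign) (C : Fin m → Bool)
                       (cycle : IsCycle G C) (unbalanced : Unbalanced G σ C) where
  open Graph G
  open SignedGraph G σ
  open Walks G

  even-degrees : ∀ v → parity (degIn G C v) ≡ false
  even-degrees v with proj₁ (proj₂ cycle) v
  ... | inj₁ d≡0 = cong parity d≡0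
  ... | inj₂ d≡2 = cong parity d≡2

  open EvenSubgraph G C even-degrees

  cycle-walk : ∀ {a b} → OnE G C a → OnE G C b → Walk G (λ e → e ∈E C) a b
  cycle-walk = proj₂ (proj₂ cycle) _ _

  odd-negative : XorSum.sum (λ k → C k ∧ isNegᵇ (σ k)) ≡ true
  odd-negative = trans (sym (parity-countB negative)) (parity-odd (countB negative) unbalanced)
    where negative = λ k → C k ∧ isNegᵇ (σ k)

  unbalanced-edge : ∀ {i} → C i ≡ true → ∀ f →
                    (∀ k → C k ≡ true → k ≢ i → coboundary f k ≡ isNegᵇ (σ k)) →
                    coboundary f i ≡ not (isNegᵇ (σ i))
  unbalanced-edge {i} i∈C f δf≡neg = begin
    coboundary f i                                          ≡⟨ edge-xor i∈C f (isNegᵇ ∘ σ) δf≡neg ⟩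
    isNegᵇ (σ i) xor XorSum.sum (λ k → C k ∧ isNegᵇ (σ k))  ≡⟨ cong (isNegᵇ (σ i) xor_) odd-negative ⟩
    isNegᵇ (σ i) xor true                                   ≡⟨ xor-comm (isNegᵇ (σ i)) true ⟩
    true xor isNegᵇ (σ i)                                   ≡⟨ true-xor (isNegᵇ (σ i)) ⟩
    not (isNegᵇ (σ i))                                      ∎
    where open ≡-Reasoning

  module CycleEdge (x : Fin n → ℚ) {i} (i∈C : C i ≡ true)
                   (consistent : ∀ k → C k ≡ true → k ≢ i → SignConsistent x k) where
    private
      p = ends₁ i
      q = ends₂ i
      y = x p
      p∈C : OnE G C p
      p∈C = i , i∈C , inj₁ refl

    ±y : Fin n → Bool
    ±y u = does (x u ≈±? y)

    ±y-cycle-edge : ∀ k → C k ≡ true → ±y (ends₁ k) ≡ ±y (ends₂ k)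
    ±y-cycle-edge = edge-invariant-everywhere
      where
      off-i : ∀ k → C k ≡ true → k ≢ i → ±y (ends₁ k) ≡ ±y (ends₂ k)
      off-i k k∈C k≢i = sym (trans (cong (λ z → does (z ≈±? y)) (consistent k k∈C k≢i))
                                   (does-≈±-sign (σ k) (x (ends₁ k)) y))
      edge-invariant-everywhere : ∀ k → C k ≡ true → ±y (ends₁ k) ≡ ±y (ends₂ k)
      edge-invariant-everywhere k k∈C with k ≟F i
      ... | yes refl = edge-invariant i∈C ±y off-i
      ... | no  k≢i  = off-i k k∈C k≢i

    on-cycle-± : ∀ {u} → OnE G C u → x u ≈± y
    on-cycle-± u∈C = does≡true⇒ (x _ ≈±? y)
      (trans (sym (walk-invariant ±y ±y-cycle-edge (cycle-walk p∈C u∈C))) (dec-true (y ≈±? y) (≈±-refl y)))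

    sign-reversed : x q ≡ - signℚ (σ i) * y
    sign-reversed with y ≟ 0ℚ | on-cycle-± (i , i∈C , inj₂ refl)
    ... | yes y≡0 | t , xq≡ty = begin
      x q                     ≡⟨ xq≡ty ⟩
      signℚ t * y             ≡⟨ cong (signℚ t *_) y≡0 ⟩
      signℚ t * 0ℚ            ≡⟨ *-zeroʳ (signℚ t) ⟩
      0ℚ                      ≡⟨ *-zeroʳ (- signℚ (σ i)) ⟨
      - signℚ (σ i) * 0ℚ      ≡⟨ cong (- signℚ (σ i) *_) y≡0 ⟨
      - signℚ (σ i) * y       ∎
      where open ≡-Reasoning
    ... | no y≢0 | t , xq≡ty = trans xq≡ty (cong (_* y) (opposite-signs (σ i) t t-test))
      where
      =y : Fin n → Bool
      =y u = does (x u ≟ y)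
      =y-sign : ∀ {u} s → x u ≡ signℚ s * y → =y u ≡ not (isNegᵇ s)
      =y-sign s xu≡sy = trans (cong (λ z → does (z ≟ y)) xu≡sy) (does-signℚ s y≢0)
      flips : ∀ k → C k ≡ true → k ≢ i → coboundary =y k ≡ isNegᵇ (σ k)
      flips k k∈C k≢i with on-cycle-± (k , k∈C , inj₁ refl)
      ... | s , x₁≡sy = begin
        =y (ends₁ k) xor =y (ends₂ k)
          ≡⟨ cong₂ _xor_ (=y-sign s x₁≡sy) (=y-sign (σ k Sign.* s) x₂≡σsy) ⟩
        not (isNegᵇ s) xor not (isNegᵇ (σ k Sign.* s))
          ≡⟨ cong (λ b → not (isNegᵇ s) xor not b) (isNegᵇ-* (σ k) s) ⟩
        not (isNegᵇ s) xor not (isNegᵇ (σ k) xor isNegᵇ s)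
          ≡⟨ xor-annihilates-not (isNegᵇ s) _ ⟩
        isNegᵇ s xor (isNegᵇ (σ k) xor isNegᵇ s)
          ≡⟨ xor-cancel-around (isNegᵇ s) (isNegᵇ (σ k)) ⟩
        isNegᵇ (σ k) ∎
        where
        open ≡-Reasoning
        x₂≡σsy : x (ends₂ k) ≡ signℚ (σ k Sign.* s) * y
        x₂≡σsy = trans (consistent k k∈C k≢i) (proj₂ (≈±-sign (σ k) (s , x₁≡sy)))
      t-test : not (isNegᵇ t) ≡ isNegᵇ (σ i)
      t-test = begin
        not (isNegᵇ t)          ≡⟨ =y-sign t xq≡ty ⟨
        =y q                    ≡⟨ not-injective (begin
          not (=y q)                ≡⟨ true-xor (=y q) ⟨
          true xor =y q             ≡⟨ cong (_xor =y q) (dec-true (y ≟ y) refl) ⟨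
          =y p xor =y q             ≡⟨ unbalanced-edge i∈C =y flips ⟩
          not (isNegᵇ (σ i))        ∎) ⟩
        isNegᵇ (σ i)            ∎
        where open ≡-Reasoning

  vanishes-on-cycle : ∀ x → (∀ k → C k ≡ true → SignConsistent x k) → ∀ {v} → OnE G C v → x v ≡ 0ℚ
  vanishes-on-cycle x consistent {v} v∈C with proj₁ cycle
  ... | i , i∈C = begin
    x v                         ≡⟨ consistent-walk consistent w ⟩
    signℚ (sgn G σ w) * x p     ≡⟨ cong (signℚ (sgn G σ w) *_) x-p≡0 ⟩
    signℚ (sgn G σ w) * 0ℚ      ≡⟨ *-zeroʳ (signℚ (sgn G σ w)) ⟩
    0ℚ                          ∎
    where
    open ≡-Reasoning
    open CycleEdge x i∈C (λ k k∈C _ → consistent k k∈C)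
    p = ends₁ i
    w = cycle-walk (i , i∈C , inj₁ refl) v∈C
    x-p≡0 : x p ≡ 0ℚ
    x-p≡0 = signℚ-*-zero (σ i) (-x≡x⇒x≡0 (begin
      - (signℚ (σ i) * x p)     ≡⟨ neg-distribˡ-* (signℚ (σ i)) (x p) ⟩
      - signℚ (σ i) * x p       ≡⟨ sign-reversed ⟨
      x (ends₂ i)               ≡⟨ consistent i i∈C ⟩
      signℚ (σ i) * x p         ∎))

module InverseRows {n m} (G : Graph n m) (σ : Fin m → Sign) (C : Fin m → Bool) (N : Fin n → Fin m → ℤ)
                   (connected : Connected G) (cycle : IsCycle G C) (unbalanced : Unbalanced G σ C)
                   (I : IsIncidence G σ N) where
  open Graph G
  open SignedGraph G σ
  open Walks G
  open Incidence G σ N I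
  open UnbalancedCycle G σ C cycle unbalanced

  cycle-vertex : ∃ (OnE G C)
  cycle-vertex with proj₁ cycle
  ... | e , e∈C = ends₁ e , e , e∈C , inj₁ refl

  trivial-left-kernel : TrivialLeftKernel A
  trivial-left-kernel r r⊙A≡0 j =
    signℚ-*-zero (sgn G σ w) (trans (sym (consistent-walk (λ k _ → consistent k) w))
                                    (vanishes-on-cycle r (λ k _ → consistent k) (proj₂ cycle-vertex)))
    where
    consistent : ∀ k → SignConsistent r k
    consistent k = orthogonal⇒consistent k r (r⊙A≡0 k)
    w = connected j (proj₁ cycle-vertex)

  module Row {i} (x : Fin n → ℚ) (row : x ⊙ A ≗ idℚ i) where
    private
      W = wt G σ N i
      InComp = InCompC G σ C i
      AvoidingWalk = Walk G (Avoid G σ i)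

    consistent : ∀ k → k ≢ i → SignConsistent x k
    consistent k k≢i = orthogonal⇒consistent k x (trans (row k) (idℚ-off (k≢i ∘ sym)))

    row-at-i : (x ⊙ A) i ≡ 1ℚ
    row-at-i = trans (row i) (idℚ-diag i)

    walk-entry : ∀ {j u} (P : AvoidingWalk j u) → x j ≡ signℚ (sgn G σ P) * x u
    walk-entry P = signℚ-flip (sgn G σ P) (consistent-walk consistent P)

    cycle-endpoint : C i ≡ true → ∀ {u} → Inc G i u → x u ≡ ½ * A u i
    cycle-endpoint i∈C (inj₁ refl) =
      half-solution (σ i) {a = A (ends₁ i) i} sign-reversed (column-equation₁ i x row-at-i)
      where open CycleEdge x i∈C (λ k _ → consistent k)
    cycle-endpoint i∈C (inj₂ refl) =
      half-solution (σ i) {a = A (ends₂ i) i} (signℚ-flip′ (σ i) sign-reversed) (column-equation₂ i x row-at-i)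
      where open CycleEdge x i∈C (λ k _ → consistent k)

    on-cycle-entry : C i ≡ true → ∀ {j} (P : AvoidingWalk (tail G σ N i) j) → x j ≡ W * (½ * signℚ (sgn G σ P))
    on-cycle-entry i∈C P = begin
      x _                      ≡⟨ consistent-walk consistent P ⟩
      s * x T                  ≡⟨ cong (s *_) (cycle-endpoint i∈C (tail-inc i)) ⟩
      s * (½ * A T i)          ≡⟨ cong (λ a → s * (½ * a)) (endpoint-entry i (tail-inc i) (λ _ → tail≢head i)) ⟩
      s * (½ * W)              ≡⟨ solve 3 (λ s h w → s :* (h :* w) := w :* (h :* s)) refl s ½ W ⟩
      W * (½ * s)              ∎
      where
      open ≡-Reasoning
      open +-*-Solver
      s = signℚ (sgn G σ P)
      T = tail G σ N i

    opposite-endpoint : ∀ {u z} → Inc G i u → Inc G i z → u ≢ z → x z ≡ 0ℚ → x u ≡ A u i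
    opposite-endpoint (inj₁ refl) (inj₁ refl) u≢z _ = ⊥-elim (u≢z refl)
    opposite-endpoint (inj₂ refl) (inj₂ refl) u≢z _ = ⊥-elim (u≢z refl)
    opposite-endpoint (inj₁ refl) (inj₂ refl) _ xz≡0 =
      trans (column-equation₁ i x row-at-i) (other-endpoint-zero (σ i) xz≡0)
    opposite-endpoint (inj₂ refl) (inj₁ refl) _ xz≡0 =
      trans (column-equation₂ i x row-at-i) (other-endpoint-zero (σ i) xz≡0)

    module OffCycle (i∉C : ¬ i ∈E C) where

      component-entry : ∀ {j} → InComp j → x j ≡ 0ℚ
      component-entry (v , v∈C , w) =
        signℚ-*-zero (sgn G σ w)
          (trans (sym (consistent-walk consistent w)) (vanishes-on-cycle x consistent-on-cycle v∈C))
        where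
        consistent-on-cycle : ∀ k → C k ≡ true → SignConsistent x k
        consistent-on-cycle k k∈C = consistent k (λ k≡i → i∉C (subst (_∈E C) k≡i k∈C))

      cycle-side : ∃ λ z → Inc G i z × InComp z
      cycle-side with cycle-vertex
      ... | v , v∈C with last-crossing i (connected (ends₁ i) v)
      ...   | inj₁ w               = ends₁ i , inj₁ refl , v , v∈C , w
      ...   | inj₂ (z , z-inc , w) = z , z-inc , v , v∈C , w

      outside : ∀ {j u} → ¬ InComp j → AvoidingWalk j u → ¬ InComp u
      outside j∉ P (v , v∈C , w) = j∉ (v , v∈C , P ++ w)

      module _ {u} (u-inc : Inc G i u) (u∉ : ¬ InComp u) where
        private
          z = proj₁ cycle-side
          z-inc = proj₁ (proj₂ cycle-side)
          z∈ = proj₂ (proj₂ cycle-side)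
          u≢z : u ≢ z
          u≢z u≡z = u∉ (subst InComp (sym u≡z) z∈)

        outside-endpoint-entry : x u ≡ A u i
        outside-endpoint-entry = opposite-endpoint u-inc z-inc u≢z (component-entry z∈)

        outside-endpoint-unique : ∀ {v} → Inc G i v → ¬ InComp v → u ≡ v
        outside-endpoint-unique v-inc v∉ =
          third-endpoint u-inc v-inc z-inc u≢z (λ v≡z → v∉ (subst InComp (sym v≡z) z∈))

      head-side-entry : ∀ {j u} → ¬ InComp j → σ i ≡ Sign.+ → InGh G σ N i j → Inc G i u →
                        (P : AvoidingWalk j u) → x j ≡ W * - signℚ (sgn G σ P)
      head-side-entry j∉ σ≡+ j∈Gh u-inc P = begin
        x _          ≡⟨ walk-entry P ⟩
        s * x _      ≡⟨ cong (λ v → s * x v) (outside-endpoint-unique u-inc (outside j∉ P) (head-inc i) H∉) ⟩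
        s * x H      ≡⟨ cong (s *_) (outside-endpoint-entry (head-inc i) H∉) ⟩
        s * A H i    ≡⟨ cong (s *_) (proj₂ (positive-entries i σ≡+)) ⟩
        s * - 1ℚ     ≡⟨ solve 1 (λ s → s :* (:- con 1ℚ) := con 1ℚ :* (:- s)) refl s ⟩
        1ℚ * - s     ≡⟨ cong (_* - s) (weight-positive i σ≡+) ⟨
        W * - s      ∎
        where
        open ≡-Reasoning
        open +-*-Solver
        s = signℚ (sgn G σ P)
        H = head G σ N i
        H∉ = outside j∉ j∈Gh

      tail-side-entry : ∀ {j u} → ¬ InComp j → ¬ (σ i ≡ Sign.+ × InGh G σ N i j) → Inc G i u →
                        (P : AvoidingWalk j u) → x j ≡ W * signℚ (sgn G σ P)
      tail-side-entry j∉ not-head-side u-inc P = begin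
        x _          ≡⟨ walk-entry P ⟩
        s * x _      ≡⟨ cong (s *_) (outside-endpoint-entry u-inc (outside j∉ P)) ⟩
        s * A _ i    ≡⟨ cong (s *_) (endpoint-entry i u-inc not-head) ⟩
        s * W        ≡⟨ *-comm s W ⟩
        W * s        ∎
        where
        open ≡-Reasoning
        s = signℚ (sgn G σ P)
        not-head : σ i ≡ Sign.+ → _ ≢ head G σ N i
        not-head σ≡+ u≡H = not-head-side (σ≡+ , subst (AvoidingWalk _) u≡H P)

sumℚ≡sum : ∀ {k} (f : Fin k → ℚ) → sumℚ f ≡ sum f
sumℚ≡sum f = foldr-tabulate _+_ 0ℚ f id

theorem3p5 : (n : ℕ) (G : Graph n n) (σ : Fin n → Sign) (C : Fin n → Bool)
    (N : Fin n → Fin n → ℤ) →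
    UnicyclicWith G C → Unbalanced G σ C → IsIncidence G σ N →
    Σ (Fin n → Fin n → ℚ) λ M → IsInverse N M × (∀ i j → EntrySpec G σ C N i j (M i j))
theorem3p5 n G σ C N (connected , cycle , _) unbalanced I = M , (left , right) , entries
  where
  open Incidence G σ N I using (A)
  open InverseRows G σ C N connected cycle unbalanced I
  inverse = invertible A trivial-left-kernel
  M = proj₁ inverse
  row : ∀ i → M i ⊙ A ≗ idℚ i
  row = proj₁ (proj₂ inverse)
  left : ∀ i k → sumℚ (λ j → M i j * A j k) ≡ idℚ i k
  left i k = trans (sumℚ≡sum (λ j → M i j * A j k)) (row i k)
  right : ∀ a b → sumℚ (λ ℓ → A a ℓ * M ℓ b) ≡ idℚ a b
  right a b = trans (sumℚ≡sum (λ ℓ → A a ℓ * M ℓ b)) (proj₂ (proj₂ inverse) a b)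
  entries : ∀ i j → EntrySpec G σ C N i j (M i j)
  entries i j = (λ i∈C P _ → on-cycle-entry i∈C P)
              , (λ i∉C j∈ → OffCycle.component-entry i∉C j∈)
              , (λ { i∉C j∉ σ≡+ j∈Gh (_ , u , P , _) → OffCycle.head-side-entry i∉C j∉ σ≡+ j∈Gh u P })
              , (λ { i∉C j∉ not-head-side (_ , u , P , _) → OffCycle.tail-side-entry i∉C j∉ not-head-side u P })
    where open Row {i} (M i) (row i)
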